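{- Let $(X,A_\tau,\rightarrow)$ be a labelled transition system. (1) Weak bisimilarity $\mathrel{\underline{\leftrightarrow}_w}$ (resp. branching bisimilarity $\mathrel{\underline{\leftrightarrow}_b}$) is itself a weak (resp. branching) bisimulation, and is the largest one. (2) Weak apartness $\mathrel{\#_w}$ (resp. branching apartness $\mathrel{\#_b}$) is itself a weak (resp. branching) apartness relation, and is the smallest one. (3) $\mathrel{\#_w}=\neg\mathrel{\underline{\leftrightarrow}_w}$ and $\mathrel{\#_b}=\neg\mathrel{\underline{\leftrightarrow}_b}$, where $\neg$ denotes complement in $X\times X$.
   Context: An LTS is a triple $(X,A_\tau,\rightarrow)$ with $X$ a set of states, $A_\tau=A\cup\{\tau\}$ where $\tau\notin A$ is the silent action, and $\rightarrow\subseteq X\times A_\tau\times X$; write $q\rightarrow_u q'$ for $(q,u,q')\in\rightarrow$. The letter $a$ ranges over $A$. $\twoheadrightarrow_\tau$ is the reflexive-transitive closure of $\rightarrow_\tau$. $R\subseteq X\times X$ is a weak bisimulation if for all states: if $q\rightarrow_\tau q'$ and $R(q,p)$ then $\exists p'(p\twoheadrightarrow_\tau p'\wedge R(q',p'))$; if $q\rightarrow_a q'$ and $R(q,p)$ then $\exists p',p'',p'''(p\twoheadrightarrow_\tau p'\rightarrow_a p''\twoheadrightarrow_\tau p'''\wedge R(q',p'''))$; if $p\rightarrow_\tau p'$ and $R(q,p)$ then $\exists q'(q\twoheadrightarrow_\tau q'\wedge R(q',p'))$; if $p\rightarrow_a p'$ and $R(q,p)$ then $\exists q',q'',q'''(q\twoheadrightarrow_\tau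 q'\rightarrow_a q''\twoheadrightarrow_\tau q'''\wedge R(q''',p'))$. $R$ is a branching bisimulation if: if $q\rightarrow_\tau q'$ and $R(q,p)$ then $R(q',p)$ or $\exists p',p''(p\twoheadrightarrow_\tau p'\rightarrow_\tau p''\wedge R(q,p')\wedge R(q',p''))$; if $q\rightarrow_a q'$ and $R(q,p)$ then $\exists p',p''(p\twoheadrightarrow_\tau p'\rightarrow_a p''\wedge R(q,p')\wedge R(q',p''))$; if $p\rightarrow_\tau p'$ and $R(q,p)$ then $R(q,p')$ or $\exists q',q''(q\twoheadrightarrow_\tau q'\rightarrow_\tau q''\wedge R(q',p)\wedge R(q'',p'))$; if $p\rightarrow_a p'$ and $R(q,p)$ then $\exists q',q''(q\twoheadrightarrow_\tau q'\rightarrow_a q''\wedge R(q',p)\wedge R(q'',p'))$. $q\mathrel{\underline{\leftrightarrow}_w}p$ (resp. $q\mathrel{\underline{\leftrightarrow}_b}p$) iff $R(q,p)$ for some weak (resp. branching) bisimulation $R$. $Q\subseteq X\times X$ is a weak apartness if: (symm) $Q(p,q)\Rightarrow Q(q,p)$; if $q\rightarrow_\tau q'$ and $Q(q',p')$ for all $p'$ with $p\twoheadrightarrow_\tau p'$, then $Q(q,p)$; if $q\rightarrow_a q'$ and $Q(q',p''')$ for all $p',p'',p'''$ with $p\twoheadrightarrow_\tau p'\rightarrow_a p''\twoheadrightarrow_\tau p'''$, then $Q(q,p)$. $Q$ is a branching apartness if: (symm); if $q\rightarrow_\tau q'$, $Q(q',p)$, and for all $p',p''$ with $p\twoheadrightarrow_\tau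 p'\rightarrow_\tau p''$ we have $Q(q,p')\vee Q(q',p'')$, then $Q(q,p)$; if $q\rightarrow_a q'$ and for all $p',p''$ with $p\twoheadrightarrow_\tau p'\rightarrow_a p''$ we have $Q(q,p')\vee Q(q',p'')$, then $Q(q,p)$. $q\mathrel{\#_w}p$ (resp. $q\mathrel{\#_b}p$) iff $Q(q,p)$ for every weak (resp. branching) apartness $Q$. -}

module Defs where

open import Level using (Level; 0ℓ; _⊔_) renaming (suc to lsuc)
open import Data.Product using (Σ; ∃; _×_; _,_)
open import Data.Sum using (_⊎_)
open import Relation.Nullary using (¬_)
open import Relation.Binary.Construct.Closure.ReflexiveTransitive using (Star)

data Act (A : Set) : Set where
  τ   : Act A
  act : A → Act A

record LTS : Set₁ where
  field
    X    : Set
    A    : Set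
    step : X → Act A → X → Set

module _ (L : LTS) where
  open LTS L

  _→τ_ : X → X → Set
  q →τ q' = step q τ q'

  _↠τ_ : X → X → Set
  _↠τ_ = Star _→τ_

  record IsWeakBisim {ℓ : Level} (R : X → X → Set ℓ) : Set ℓ where
    field
      τ-l : ∀ {q q' p} → step q τ q' → R q p →
            Σ X λ p' → (p ↠τ p') × R q' p'
      a-l : ∀ {q q' p} (a : A) → step q (act a) q' → R q p →
            Σ X λ p' → Σ X λ p'' → Σ X λ p''' →
              (p ↠τ p') × step p' (act a) p'' × (p'' ↠τ p''') × R q' p'''
      τ-r : ∀ {q p p'} → step p τ p' → R q p →
            Σ X λ q' → (q ↠τ q') × R q' p'
      a-r : ∀ {q p p'} (a : A) → step p (act a) p' → R q p →
            Σ X λ q' → Σ X λ q'' → Σ X λ q''' →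
              (q ↠τ q') × step q' (act a) q'' × (q'' ↠τ q''') × R q''' p'

  record IsBranchingBisim {ℓ : Level} (R : X → X → Set ℓ) : Set ℓ where
    field
      τ-l : ∀ {q q' p} → step q τ q' → R q p →
            R q' p ⊎ (Σ X λ p' → Σ X λ p'' →
              (p ↠τ p') × step p' τ p'' × R q p' × R q' p'')
      a-l : ∀ {q q' p} (a : A) → step q (act a) q' → R q p →
            Σ X λ p' → Σ X λ p'' →
              (p ↠τ p') × step p' (act a) p'' × R q p' × R q' p''
      τ-r : ∀ {q p p'} → step p τ p' → R q p →
            R q p' ⊎ (Σ X λ q' → Σ X λ q'' →
              (q ↠τ q') × step q' τ q'' × R q' p × R q'' p')
      a-r : ∀ {q p p'} (a : A) → step p (act a) p' → R q p →
            Σ X λ q' → Σ X λ q'' →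
              (q ↠τ q') × step q' (act a) q'' × R q' p × R q'' p'

  record IsWeakApart {ℓ : Level} (Q : X → X → Set ℓ) : Set ℓ where
    field
      symm : ∀ {p q} → Q p q → Q q p
      τ-in : ∀ {q q' p} → step q τ q' →
             (∀ p' → p ↠τ p' → Q q' p') → Q q p
      a-in : ∀ {q q' p} (a : A) → step q (act a) q' →
             (∀ p' p'' p''' → p ↠τ p' → step p' (act a) p'' → p'' ↠τ p''' → Q q' p''') →
             Q q p

  record IsBranchingApart {ℓ : Level} (Q : X → X → Set ℓ) : Set ℓ where
    field
      symm : ∀ {p q} → Q p q → Q q p
      τ-in : ∀ {q q' p} → step q τ q' → Q q' p →
             (∀ p' p'' → p ↠τ p' → step p' τ p'' → Q q p' ⊎ Q q' p'') → Q q p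
      a-in : ∀ {q q' p} (a : A) → step q (act a) q' →
             (∀ p' p'' → p ↠τ p' → step p' (act a) p'' → Q q p' ⊎ Q q' p'') → Q q p

  _↔w_ : X → X → Set₁
  q ↔w p = Σ (X → X → Set) λ R → IsWeakBisim R × R q p

  _↔b_ : X → X → Set₁
  q ↔b p = Σ (X → X → Set) λ R → IsBranchingBisim R × R q p

  _#w_ : X → X → Set₁
  q #w p = (Q : X → X → Set) → IsWeakApart Q → Q q p

  _#b_ : X → X → Set₁
  q #b p = (Q : X → X → Set) → IsBranchingApart Q → Q q p

-- Apartness is the inductive dual of bisimilarity. Bisimilarity, the union of all
-- bisimulations, is a bisimulation because every transfer clause is witnessed inside a
-- single bisimulation; dually apartness, the intersection of all apartness relations, is
-- closed under the derivation rules. For any bisimulation R the pairs unrelated by R in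
-- either direction form an apartness, so apart states are never bisimilar. Conversely,
-- classically, the complement of an apartness is a bisimulation: a failing transfer clause
-- would supply exactly the premises of a derivation rule.
module Submission where

open import Defs
open import Level using (Level; 0ℓ; _⊔_; Lift; lift; lower) renaming (suc to lsuc)
open import Data.Product using (_×_; _,_; proj₁; proj₂; swap)
open import Data.Sum using (_⊎_; inj₁; inj₂; [_,_])
import Data.Sum as Sum
open import Data.Empty using (⊥)
open import Function using (_∘_)
open import Relation.Nullary using (¬_)
open import Relation.Nullary.Decidable using (map′)
open import Axiom.ExcludedMiddle using (ExcludedMiddle)
open import Axiom.DoubleNegationElimination using (DoubleNegationElimination; em⇒dne)

private
  variable
    ℓ : Level

lower-excludedMiddle : ∀ {a} ℓ → ExcludedMiddle (a ⊔ ℓ) → ExcludedMiddle a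
lower-excludedMiddle ℓ em = map′ lower lift (em {Lift ℓ _})

¬[¬×¬]⇒⊎ : DoubleNegationElimination ℓ → {A B : Set ℓ} → ¬ (¬ A × ¬ B) → A ⊎ B
¬[¬×¬]⇒⊎ dne ¬[¬A×¬B] = dne λ ¬A⊎B → ¬[¬A×¬B] (¬A⊎B ∘ inj₁ , ¬A⊎B ∘ inj₂)

module _ (L : LTS) where
  open LTS L

  Unrelated : (X → X → Set ℓ) → X → X → Set ℓ
  Unrelated R x y = ¬ R x y × ¬ R y x

  Complement : (X → X → Set ℓ) → X → X → Set ℓ
  Complement Q x y = ¬ Q x y

  ↔w-greatest : (R : X → X → Set) → IsWeakBisim L R → ∀ q p → R q p → _↔w_ L q p
  ↔w-greatest R isR q p r = R , isR , r

  ↔w-isWeakBisim : IsWeakBisim L (_↔w_ L)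
  ↔w-isWeakBisim = record
    { τ-l = λ { st (R , isR , r) →
        let p' , s , r' = IsWeakBisim.τ-l isR st r in p' , s , ↔w-greatest R isR _ _ r' }
    ; a-l = λ { a st (R , isR , r) →
        let p' , p'' , p''' , s₁ , s₂ , s₃ , r' = IsWeakBisim.a-l isR a st r
        in p' , p'' , p''' , s₁ , s₂ , s₃ , ↔w-greatest R isR _ _ r' }
    ; τ-r = λ { st (R , isR , r) →
        let q' , s , r' = IsWeakBisim.τ-r isR st r in q' , s , ↔w-greatest R isR _ _ r' }
    ; a-r = λ { a st (R , isR , r) →
        let q' , q'' , q''' , s₁ , s₂ , s₃ , r' = IsWeakBisim.a-r isR a st r
        in q' , q'' , q''' , s₁ , s₂ , s₃ , ↔w-greatest R isR _ _ r' }
    }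

  ↔b-greatest : (R : X → X → Set) → IsBranchingBisim L R → ∀ q p → R q p → _↔b_ L q p
  ↔b-greatest R isR q p r = R , isR , r

  ↔b-isBranchingBisim : IsBranchingBisim L (_↔b_ L)
  ↔b-isBranchingBisim = record
    { τ-l = λ { st (R , isR , r) →
        Sum.map (↔b-greatest R isR _ _)
                (λ (p' , p'' , s₁ , s₂ , r₁ , r₂) →
                   p' , p'' , s₁ , s₂ , ↔b-greatest R isR _ _ r₁ , ↔b-greatest R isR _ _ r₂)
                (IsBranchingBisim.τ-l isR st r) }
    ; a-l = λ { a st (R , isR , r) →
        let p' , p'' , s₁ , s₂ , r₁ , r₂ = IsBranchingBisim.a-l isR a st r
        in p' , p'' , s₁ , s₂ , ↔b-greatest R isR _ _ r₁ , ↔b-greatest R isR _ _ r₂ }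
    ; τ-r = λ { st (R , isR , r) →
        Sum.map (↔b-greatest R isR _ _)
                (λ (q' , q'' , s₁ , s₂ , r₁ , r₂) →
                   q' , q'' , s₁ , s₂ , ↔b-greatest R isR _ _ r₁ , ↔b-greatest R isR _ _ r₂)
                (IsBranchingBisim.τ-r isR st r) }
    ; a-r = λ { a st (R , isR , r) →
        let q' , q'' , s₁ , s₂ , r₁ , r₂ = IsBranchingBisim.a-r isR a st r
        in q' , q'' , s₁ , s₂ , ↔b-greatest R isR _ _ r₁ , ↔b-greatest R isR _ _ r₂ }
    }

  #w-least : (Q : X → X → Set) → IsWeakApart L Q → ∀ q p → _#w_ L q p → Q q p
  #w-least Q isQ q p q#p = q#p Q isQ

  #w-isWeakApart : IsWeakApart L (_#w_ L)
  #w-isWeakApart = record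
    { symm = λ q#p Q isQ → IsWeakApart.symm isQ (q#p Q isQ)
    ; τ-in = λ st apart Q isQ → IsWeakApart.τ-in isQ st (λ p' s → apart p' s Q isQ)
    ; a-in = λ a st apart Q isQ →
        IsWeakApart.a-in isQ a st (λ p' p'' p''' s₁ s₂ s₃ → apart p' p'' p''' s₁ s₂ s₃ Q isQ)
    }

  #b-least : (Q : X → X → Set) → IsBranchingApart L Q → ∀ q p → _#b_ L q p → Q q p
  #b-least Q isQ q p q#p = q#p Q isQ

  #b-isBranchingApart : IsBranchingApart L (_#b_ L)
  #b-isBranchingApart = record
    { symm = λ q#p Q isQ → IsBranchingApart.symm isQ (q#p Q isQ)
    ; τ-in = λ st q'#p apart Q isQ → IsBranchingApart.τ-in isQ st (q'#p Q isQ)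
        (λ p' p'' s₁ s₂ → instantiate Q isQ (apart p' p'' s₁ s₂))
    ; a-in = λ a st apart Q isQ → IsBranchingApart.a-in isQ a st
        (λ p' p'' s₁ s₂ → instantiate Q isQ (apart p' p'' s₁ s₂))
    }
    where
    instantiate : ∀ {a b c d} (Q : X → X → Set) → IsBranchingApart L Q →
                  _#b_ L a b ⊎ _#b_ L c d → Q a b ⊎ Q c d
    instantiate Q isQ = Sum.map (λ a#b → a#b Q isQ) (λ c#d → c#d Q isQ)

  unrelated-isWeakApart : {R : X → X → Set ℓ} → IsWeakBisim L R →
                          IsWeakApart L (Unrelated R)
  unrelated-isWeakApart isR = record
    { symm = swap
    ; τ-in = λ st apart →
        (λ r → let p' , s , r' = τ-l st r in proj₁ (apart p' s) r')
      , (λ r → let p' , s , r' = τ-r st r in proj₂ (apart p' s) r')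
    ; a-in = λ a st apart →
        (λ r → let p' , p'' , p''' , s₁ , s₂ , s₃ , r' = a-l a st r
               in proj₁ (apart p' p'' p''' s₁ s₂ s₃) r')
      , (λ r → let p' , p'' , p''' , s₁ , s₂ , s₃ , r' = a-r a st r
               in proj₂ (apart p' p'' p''' s₁ s₂ s₃) r')
    }
    where open IsWeakBisim isR

  unrelated-isBranchingApart : {R : X → X → Set ℓ} → IsBranchingBisim L R →
                               IsBranchingApart L (Unrelated R)
  unrelated-isBranchingApart {R = R} isR = record
    { symm = swap
    ; τ-in = λ st q'≁p apart →
        (λ r → [ proj₁ q'≁p
               , (λ (p' , p'' , s₁ , s₂ , r₁ , r₂) → neither (apart p' p'' s₁ s₂) r₁ r₂)
               ] (τ-l st r))
      , (λ r → [ proj₂ q'≁p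
               , (λ (p' , p'' , s₁ , s₂ , r₁ , r₂) →
                    neither (Sum.map swap swap (apart p' p'' s₁ s₂)) r₁ r₂)
               ] (τ-r st r))
    ; a-in = λ a st apart →
        (λ r → let p' , p'' , s₁ , s₂ , r₁ , r₂ = a-l a st r
               in neither (apart p' p'' s₁ s₂) r₁ r₂)
      , (λ r → let p' , p'' , s₁ , s₂ , r₁ , r₂ = a-r a st r
               in neither (Sum.map swap swap (apart p' p'' s₁ s₂)) r₁ r₂)
    }
    where
    open IsBranchingBisim isR

    neither : ∀ {a b c d} → Unrelated R a b ⊎ Unrelated R c d → R a b → R c d → ⊥
    neither (inj₁ a≁b) r _ = proj₁ a≁b r
    neither (inj₂ c≁d) _ r = proj₁ c≁d r

  complement-isWeakBisim : DoubleNegationElimination ℓ → {Q : X → X → Set ℓ} →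
                           IsWeakApart L Q → IsWeakBisim L (Complement Q)
  complement-isWeakBisim dne isQ = record
    { τ-l = λ st ¬Qqp → dne λ ¬match → ¬Qqp (τ-in st λ p' s →
        dne λ ¬Q → ¬match (p' , s , ¬Q))
    ; a-l = λ a st ¬Qqp → dne λ ¬match → ¬Qqp (a-in a st λ p' p'' p''' s₁ s₂ s₃ →
        dne λ ¬Q → ¬match (p' , p'' , p''' , s₁ , s₂ , s₃ , ¬Q))
    ; τ-r = λ st ¬Qqp → dne λ ¬match → ¬Qqp (symm (τ-in st λ q' s →
        symm (dne λ ¬Q → ¬match (q' , s , ¬Q))))
    ; a-r = λ a st ¬Qqp → dne λ ¬match → ¬Qqp (symm (a-in a st λ q' q'' q''' s₁ s₂ s₃ →
        symm (dne λ ¬Q → ¬match (q' , q'' , q''' , s₁ , s₂ , s₃ , ¬Q))))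
    }
    where open IsWeakApart isQ

  complement-isBranchingBisim : DoubleNegationElimination ℓ → {Q : X → X → Set ℓ} →
                                IsBranchingApart L Q → IsBranchingBisim L (Complement Q)
  complement-isBranchingBisim dne {Q} isQ = record
    { τ-l = λ st ¬Qqp → dne λ ¬match → ¬Qqp (τ-in st (dne (¬match ∘ inj₁))
        λ p' p'' s₁ s₂ → either λ (¬Q₁ , ¬Q₂) → ¬match (inj₂ (p' , p'' , s₁ , s₂ , ¬Q₁ , ¬Q₂)))
    ; a-l = λ a st ¬Qqp → dne λ ¬match → ¬Qqp (a-in a st
        λ p' p'' s₁ s₂ → either λ (¬Q₁ , ¬Q₂) → ¬match (p' , p'' , s₁ , s₂ , ¬Q₁ , ¬Q₂))
    ; τ-r = λ st ¬Qqp → dne λ ¬match → ¬Qqp (symm (τ-in st (symm (dne (¬match ∘ inj₁)))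
        λ q' q'' s₁ s₂ → Sum.map symm symm (either λ (¬Q₁ , ¬Q₂) →
          ¬match (inj₂ (q' , q'' , s₁ , s₂ , ¬Q₁ , ¬Q₂)))))
    ; a-r = λ a st ¬Qqp → dne λ ¬match → ¬Qqp (symm (a-in a st
        λ q' q'' s₁ s₂ → Sum.map symm symm (either λ (¬Q₁ , ¬Q₂) →
          ¬match (q' , q'' , s₁ , s₂ , ¬Q₁ , ¬Q₂))))
    }
    where
    open IsBranchingApart isQ

    either : ∀ {a b c d} → ¬ (Complement Q a b × Complement Q c d) → Q a b ⊎ Q c d
    either = ¬[¬×¬]⇒⊎ dne

  #w⇒¬↔w : ∀ q p → _#w_ L q p → ¬ _↔w_ L q p
  #w⇒¬↔w q p q#p (R , isR , r) =
    proj₁ (#w-least (Unrelated R) (unrelated-isWeakApart isR) q p q#p) r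

  #b⇒¬↔b : ∀ q p → _#b_ L q p → ¬ _↔b_ L q p
  #b⇒¬↔b q p q#p (R , isR , r) =
    proj₁ (#b-least (Unrelated R) (unrelated-isBranchingApart isR) q p q#p) r

  ¬↔w⇒#w : DoubleNegationElimination 0ℓ → ∀ q p → ¬ _↔w_ L q p → _#w_ L q p
  ¬↔w⇒#w dne q p ¬q↔p Q isQ = dne λ ¬Qqp →
    ¬q↔p (↔w-greatest (Complement Q) (complement-isWeakBisim dne isQ) q p ¬Qqp)

  ¬↔b⇒#b : DoubleNegationElimination 0ℓ → ∀ q p → ¬ _↔b_ L q p → _#b_ L q p
  ¬↔b⇒#b dne q p ¬q↔p Q isQ = dne λ ¬Qqp →
    ¬q↔p (↔b-greatest (Complement Q) (complement-isBranchingBisim dne isQ) q p ¬Qqp)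

lemma3p11 : (L : LTS) → let open LTS L in
    -- (1) bisimilarity is a bisimulation, and the largest one
    ((IsWeakBisim L (_↔w_ L)
        × ((R : X → X → Set) → IsWeakBisim L R → ∀ q p → R q p → _↔w_ L q p))
     × (IsBranchingBisim L (_↔b_ L)
        × ((R : X → X → Set) → IsBranchingBisim L R → ∀ q p → R q p → _↔b_ L q p)))
    -- (2) apartness is an apartness relation, and the smallest one
    × ((IsWeakApart L (_#w_ L)
        × ((Q : X → X → Set) → IsWeakApart L Q → ∀ q p → _#w_ L q p → Q q p))
     × (IsBranchingApart L (_#b_ L)
        × ((Q : X → X → Set) → IsBranchingApart L Q → ∀ q p → _#b_ L q p → Q q p)))
    -- (3) apartness is the complement of bisimilarity (classical ambient logic)
    × (ExcludedMiddle (lsuc 0ℓ) →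
        ((∀ q p → _#w_ L q p → ¬ _↔w_ L q p) × (∀ q p → ¬ _↔w_ L q p → _#w_ L q p))
      × ((∀ q p → _#b_ L q p → ¬ _↔b_ L q p) × (∀ q p → ¬ _↔b_ L q p → _#b_ L q p)))
lemma3p11 L =
    ((↔w-isWeakBisim L , ↔w-greatest L) , (↔b-isBranchingBisim L , ↔b-greatest L))
  , ((#w-isWeakApart L , #w-least L) , (#b-isBranchingApart L , #b-least L))
  , λ em → let dne = em⇒dne (lower-excludedMiddle (lsuc 0ℓ) em) in
      (#w⇒¬↔w L , ¬↔w⇒#w L dne) , (#b⇒¬↔b L , ¬↔b⇒#b L dne)
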